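{- Let $\mathcal{C}$ be a category satisfying the coproduct assumption below. The mapping $X\mapsto\mathrm{Pred}(X)$ then extends to a functor $\mathrm{Pred}\colon\mathcal{C}^{\mathrm{op}}\to\mathbf{EA}$, where, on an arrow $f\colon X\to Y$ in $\mathcal{C}$, one writes $f^*=\mathrm{Pred}(f)\colon\mathrm{Pred}(Y)\to\mathrm{Pred}(X)$, defined for $q\in\mathrm{Pred}(Y)$ as the unique mediating map $f^*(q)\colon X\to X+X$ into the pullback (D) with $\nabla\circ f^*(q)=\mathrm{id}$ and $(f+f)\circ f^*(q)=q\circ f$.
   Context: A predicate on $X$ is a map $p\colon X\to X+X$ with $\nabla\circ p=\mathrm{id}$, where $\nabla=[\mathrm{id},\mathrm{id}]$; $\mathrm{Pred}(X)$ is their set, with $1=\kappa_1$, $0=\kappa_2$, $p^\perp=[\kappa_2,\kappa_1]\circ p$, and partial sum $p\boxplus q=(\nabla+\mathrm{id})\circ b$ defined when a bound $b\colon X\to(X+X)+X$ exists with $[\mathrm{id},\kappa_2]\circ b=p$, $[[\kappa_2,\kappa_1],\kappa_2]\circ b=q$. Coproduct assumption: (i) the squares (E) $(\mathrm{id}+g)$/$(f+\mathrm{id})$ between $A+X,A+Y,B+X,B+Y$, (K) $f,\kappa_1,\kappa_1,f+\mathrm{id}$ between $X,Y,X+A,Y+A$, and (K+) $f,\kappa_1,\kappa_1,f+g$ between $X,Y,X+A,Y+B$ are pullbacks; (ii) $[\mathrm{id},\kappa_2],[[\kappa_2,\kappa_1],\kappa_2]\colon(X+X)+X\rightrightarrows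 X+X$ are jointly monic; (iii) the squares (D) with $f+f\colon X+X\to Y+Y$, $\nabla$, $\nabla$, $f\colon X\to Y$, and (D+) with $(f+f)+f$, $\nabla+\mathrm{id}$, $\nabla+\mathrm{id}$, $f+f$, are pullbacks. $\mathbf{EA}$ is the category of effect algebras (partial commutative monoids with orthocomplement) with maps preserving $1$ and $\boxplus$. Here $\boxplus$ denotes the partial sum operation. -}

module Defs where

open import Level using (Level; _⊔_) renaming (suc to lsuc)
open import Data.Product using (Σ; Σ-syntax; _×_; _,_; proj₁; proj₂)
open import Relation.Binary.Core using (Rel)
open import Relation.Binary.Structures using (IsEquivalence)
open import Relation.Binary.PropositionalEquality
  using (_≡_; refl; sym; trans; cong; cong₂; module ≡-Reasoning)

record Category (o ℓ : Level) : Set (lsuc (o ⊔ ℓ)) where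
  infixr 9 _∘_
  infix 4 _⇒_
  field
    Obj : Set o
    _⇒_ : Obj → Obj → Set ℓ
    id  : ∀ {A} → A ⇒ A
    _∘_ : ∀ {A B C} → B ⇒ C → A ⇒ B → A ⇒ C
    identityˡ : ∀ {A B} {f : A ⇒ B} → id ∘ f ≡ f
    identityʳ : ∀ {A B} {f : A ⇒ B} → f ∘ id ≡ f
    assoc : ∀ {A B C D} {f : A ⇒ B} {g : B ⇒ C} {h : C ⇒ D} →
            (h ∘ g) ∘ f ≡ h ∘ (g ∘ f)

record Coproducts {o ℓ} (C : Category o ℓ) : Set (o ⊔ ℓ) where
  open Category C
  infixr 6 _+_
  field
    _+_ : Obj → Obj → Obj
    κ₁ : ∀ {A B} → A ⇒ A + B
    κ₂ : ∀ {A B} → B ⇒ A + B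
    [_,_] : ∀ {A B Z} → A ⇒ Z → B ⇒ Z → A + B ⇒ Z
    inject₁ : ∀ {A B Z} {f : A ⇒ Z} {g : B ⇒ Z} → [ f , g ] ∘ κ₁ ≡ f
    inject₂ : ∀ {A B Z} {f : A ⇒ Z} {g : B ⇒ Z} → [ f , g ] ∘ κ₂ ≡ g
    unique : ∀ {A B Z} {f : A ⇒ Z} {g : B ⇒ Z} {h : A + B ⇒ Z} →
             h ∘ κ₁ ≡ f → h ∘ κ₂ ≡ g → [ f , g ] ≡ h

  ∇ : ∀ {A} → A + A ⇒ A
  ∇ = [ id , id ]

  infixr 7 _+₁_
  _+₁_ : ∀ {A B X Y} → A ⇒ B → X ⇒ Y → A + X ⇒ B + Y
  f +₁ g = [ κ₁ ∘ f , κ₂ ∘ g ]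

  swap : ∀ {A B} → A + B ⇒ B + A
  swap = [ κ₂ , κ₁ ]

  ▷₁ : ∀ {X} → (X + X) + X ⇒ X + X
  ▷₁ = [ id , κ₂ ]

  ▷₂ : ∀ {X} → (X + X) + X ⇒ X + X
  ▷₂ = [ swap , κ₂ ]

module _ {o ℓ} (C : Category o ℓ) where
  open Category C

  record IsPullback {P A B Z : Obj} (p₁ : P ⇒ A) (p₂ : P ⇒ B)
                    (f : A ⇒ Z) (g : B ⇒ Z) : Set (o ⊔ ℓ) where
    field
      commute : f ∘ p₁ ≡ g ∘ p₂
      universal : ∀ {Q} (h₁ : Q ⇒ A) (h₂ : Q ⇒ B) → f ∘ h₁ ≡ g ∘ h₂ → Q ⇒ P
      p₁∘universal : ∀ {Q} {h₁ : Q ⇒ A} {h₂ : Q ⇒ B} (eq : f ∘ h₁ ≡ g ∘ h₂) →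
                     p₁ ∘ universal h₁ h₂ eq ≡ h₁
      p₂∘universal : ∀ {Q} {h₁ : Q ⇒ A} {h₂ : Q ⇒ B} (eq : f ∘ h₁ ≡ g ∘ h₂) →
                     p₂ ∘ universal h₁ h₂ eq ≡ h₂
      unique-mediator : ∀ {Q} {h₁ : Q ⇒ A} {h₂ : Q ⇒ B} {eq : f ∘ h₁ ≡ g ∘ h₂}
                        (u : Q ⇒ P) → p₁ ∘ u ≡ h₁ → p₂ ∘ u ≡ h₂ →
                        u ≡ universal h₁ h₂ eq

record CoproductAssumption {o ℓ} (C : Category o ℓ) (cp : Coproducts C)
       : Set (o ⊔ ℓ) where
  open Category C
  open Coproducts cp
  field
    E : ∀ {A B X Y} (f : A ⇒ B) (g : X ⇒ Y) →
        IsPullback C {A + X} {B + X} {A + Y} {B + Y}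
          (f +₁ id) (id +₁ g) (id +₁ g) (f +₁ id)
    K : ∀ {X Y A} (f : X ⇒ Y) →
        IsPullback C {X} {Y} {X + A} {Y + A} f κ₁ κ₁ (f +₁ id)
    K+ : ∀ {X Y A B} (f : X ⇒ Y) (g : A ⇒ B) →
         IsPullback C {X} {Y} {X + A} {Y + B} f κ₁ κ₁ (f +₁ g)
    jointly-monic : ∀ {X Z} {h k : Z ⇒ (X + X) + X} →
                    ▷₁ ∘ h ≡ ▷₁ ∘ k → ▷₂ ∘ h ≡ ▷₂ ∘ k → h ≡ k
    D : ∀ {X Y} (f : X ⇒ Y) →
        IsPullback C {X + X} {X} {Y + Y} {Y} ∇ (f +₁ f) f ∇
    D+ : ∀ {X Y} (f : X ⇒ Y) →
         IsPullback C {(X + X) + X} {X + X} {(Y + Y) + Y} {Y + Y}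
           (∇ +₁ id) ((f +₁ f) +₁ f) (f +₁ f) (∇ +₁ id)

record IsEffectAlgebra {a ℓ₁ ℓ₂} {A : Set a} (_≈_ : Rel A ℓ₁) (_⊥_ : Rel A ℓ₂)
       (_⊞_ : ∀ x y → x ⊥ y → A) (𝟘 𝟙 : A) (_ᗮ : A → A)
       : Set (a ⊔ ℓ₁ ⊔ ℓ₂) where
  field
    isEquivalence : IsEquivalence _≈_
    ⊥-resp-≈ : ∀ {x x′ y y′} → x ≈ x′ → y ≈ y′ → x ⊥ y → x′ ⊥ y′
    -- congruence (in particular independence of the definedness witness)
    ⊞-cong : ∀ {x x′ y y′} (d : x ⊥ y) (d′ : x′ ⊥ y′) → x ≈ x′ → y ≈ y′ →
             (x ⊞ y) d ≈ (x′ ⊞ y′) d′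
    ᗮ-cong : ∀ {x y} → x ≈ y → (x ᗮ) ≈ (y ᗮ)
    ⊥-comm : ∀ {x y} → x ⊥ y → y ⊥ x
    ⊞-comm : ∀ {x y} (d : x ⊥ y) → (x ⊞ y) d ≈ (y ⊞ x) (⊥-comm d)
    ⊥-assocʳ : ∀ {x y z} (d : x ⊥ y) → (x ⊞ y) d ⊥ z → y ⊥ z
    ⊥-assocˡ : ∀ {x y z} (d : x ⊥ y) (e : (x ⊞ y) d ⊥ z) →
               x ⊥ (y ⊞ z) (⊥-assocʳ d e)
    ⊞-assoc : ∀ {x y z} (d : x ⊥ y) (e : (x ⊞ y) d ⊥ z) →
              ((x ⊞ y) d ⊞ z) e ≈ (x ⊞ (y ⊞ z) (⊥-assocʳ d e)) (⊥-assocˡ d e)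
    ⊥-𝟘 : ∀ {x} → x ⊥ 𝟘
    ⊞-identityʳ : ∀ {x} → (x ⊞ 𝟘) ⊥-𝟘 ≈ x
    ⊥-ᗮ : ∀ {x} → x ⊥ (x ᗮ)
    ⊞-ᗮ : ∀ {x} → (x ⊞ (x ᗮ)) ⊥-ᗮ ≈ 𝟙
    ᗮ-unique : ∀ {x y} (d : x ⊥ y) → (x ⊞ y) d ≈ 𝟙 → y ≈ (x ᗮ)
    zero-one : ∀ {x} → x ⊥ 𝟙 → x ≈ 𝟘

record IsEAMap {a b ℓ₁ ℓ₂ ℓ₃ ℓ₄} {A : Set a} {B : Set b}
       (_≈₁_ : Rel A ℓ₁) (_⊥₁_ : Rel A ℓ₂) (_⊞₁_ : ∀ x y → x ⊥₁ y → A) (𝟙₁ : A)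
       (_≈₂_ : Rel B ℓ₃) (_⊥₂_ : Rel B ℓ₄) (_⊞₂_ : ∀ x y → x ⊥₂ y → B) (𝟙₂ : B)
       (h : A → B) : Set (a ⊔ ℓ₁ ⊔ ℓ₂ ⊔ ℓ₃ ⊔ ℓ₄) where
  field
    h-cong : ∀ {x y} → x ≈₁ y → h x ≈₂ h y
    pres-𝟙 : h 𝟙₁ ≈₂ 𝟙₂
    pres-⊥ : ∀ {x y} → x ⊥₁ y → h x ⊥₂ h y
    pres-⊞ : ∀ {x y} (d : x ⊥₁ y) → h ((x ⊞₁ y) d) ≈₂ (h x ⊞₂ h y) (pres-⊥ d)

module Predicates {o ℓ} (C : Category o ℓ) (cp : Coproducts C) where
  open Category C
  open Coproducts cp
  open ≡-Reasoning

  +-ext : ∀ {A B Z} {h k : A + B ⇒ Z} → h ∘ κ₁ ≡ k ∘ κ₁ → h ∘ κ₂ ≡ k ∘ κ₂ → h ≡ k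
  +-ext {h = h} {k} e₁ e₂ = trans (sym (unique refl refl)) (unique (sym e₁) (sym e₂))

  ∘-κ₁ : ∀ {A B Z W} {h : Z ⇒ W} {f : A ⇒ Z} {g : B ⇒ Z} → (h ∘ [ f , g ]) ∘ κ₁ ≡ h ∘ f
  ∘-κ₁ = trans assoc (cong (_ ∘_) inject₁)

  ∘-κ₂ : ∀ {A B Z W} {h : Z ⇒ W} {f : A ⇒ Z} {g : B ⇒ Z} → (h ∘ [ f , g ]) ∘ κ₂ ≡ h ∘ g
  ∘-κ₂ = trans assoc (cong (_ ∘_) inject₂)

  record Pred (X : Obj) : Set ℓ where
    constructor pred
    field
      map : X ⇒ X + X
      law : ∇ ∘ map ≡ id
  open Pred public

  _≈ₚ_ : ∀ {X} → Rel (Pred X) ℓ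
  p ≈ₚ q = map p ≡ map q

  𝟙ₚ : ∀ {X} → Pred X
  𝟙ₚ = pred κ₁ inject₁

  𝟘ₚ : ∀ {X} → Pred X
  𝟘ₚ = pred κ₂ inject₂

  ∇∘swap : ∀ {X} → ∇ ∘ swap ≡ ∇ {X}
  ∇∘swap = +-ext (trans ∘-κ₁ (trans inject₂ (sym inject₁)))
                 (trans ∘-κ₂ (trans inject₁ (sym inject₂)))

  _ᗮₚ : ∀ {X} → Pred X → Pred X
  p ᗮₚ = pred (swap ∘ map p)
    (begin ∇ ∘ (swap ∘ map p) ≡⟨ sym assoc ⟩
           (∇ ∘ swap) ∘ map p ≡⟨ cong (_∘ map p) ∇∘swap ⟩
           ∇ ∘ map p          ≡⟨ law p ⟩
           id ∎)

  Bound : ∀ {X} → Pred X → Pred X → Set ℓ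
  Bound {X} p q = Σ[ b ∈ X ⇒ (X + X) + X ] ((▷₁ ∘ b ≡ map p) × (▷₂ ∘ b ≡ map q))

  _⊥ₚ_ : ∀ {X} → Rel (Pred X) ℓ
  p ⊥ₚ q = Bound p q

  ∇∘∇+id : ∀ {X} → ∇ ∘ (∇ +₁ id) ≡ ∇ ∘ ▷₁ {X}
  ∇∘∇+id = +-ext
    (begin (∇ ∘ (∇ +₁ id)) ∘ κ₁ ≡⟨ ∘-κ₁ ⟩
           ∇ ∘ (κ₁ ∘ ∇)         ≡⟨ sym assoc ⟩
           (∇ ∘ κ₁) ∘ ∇         ≡⟨ cong (_∘ ∇) inject₁ ⟩
           id ∘ ∇               ≡⟨ identityˡ ⟩
           ∇                    ≡⟨ sym identityʳ ⟩
           ∇ ∘ id               ≡⟨ sym ∘-κ₁ ⟩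
           (∇ ∘ ▷₁) ∘ κ₁ ∎)
    (begin (∇ ∘ (∇ +₁ id)) ∘ κ₂ ≡⟨ ∘-κ₂ ⟩
           ∇ ∘ (κ₂ ∘ id)        ≡⟨ cong (∇ ∘_) identityʳ ⟩
           ∇ ∘ κ₂               ≡⟨ sym ∘-κ₂ ⟩
           (∇ ∘ ▷₁) ∘ κ₂ ∎)

  _⊞ₚ_ : ∀ {X} (p q : Pred X) → p ⊥ₚ q → Pred X
  (p ⊞ₚ q) (b , e₁ , e₂) = pred ((∇ +₁ id) ∘ b)
    (begin ∇ ∘ ((∇ +₁ id) ∘ b) ≡⟨ sym assoc ⟩
           (∇ ∘ (∇ +₁ id)) ∘ b ≡⟨ cong (_∘ b) ∇∘∇+id ⟩
           (∇ ∘ ▷₁) ∘ b        ≡⟨ assoc ⟩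
           ∇ ∘ (▷₁ ∘ b)        ≡⟨ cong (∇ ∘_) e₁ ⟩
           ∇ ∘ map p           ≡⟨ law p ⟩
           id ∎)

  module Substitution (CA : CoproductAssumption C cp) where
    open CoproductAssumption CA

    private
      eq* : ∀ {X Y} (f : X ⇒ Y) (q : Pred Y) → f ∘ id ≡ ∇ ∘ (map q ∘ f)
      eq* f q = begin f ∘ id          ≡⟨ identityʳ ⟩
                      f               ≡⟨ sym identityˡ ⟩
                      id ∘ f          ≡⟨ cong (_∘ f) (sym (law q)) ⟩
                      (∇ ∘ map q) ∘ f ≡⟨ assoc ⟩
                      ∇ ∘ (map q ∘ f) ∎

    _* : ∀ {X Y} → X ⇒ Y → Pred Y → Pred X
    (f *) q = pred (IsPullback.universal (D f) id (map q ∘ f) (eq* f q))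
                   (IsPullback.p₁∘universal (D f) (eq* f q))

    record PredFunctor : Set (o ⊔ ℓ) where
      field
        Pred-isEffectAlgebra : ∀ (X : Obj) →
          IsEffectAlgebra (_≈ₚ_ {X}) _⊥ₚ_ _⊞ₚ_ 𝟘ₚ 𝟙ₚ _ᗮₚ
        *-isEAMap : ∀ {X Y} (f : X ⇒ Y) →
          IsEAMap (_≈ₚ_ {Y}) _⊥ₚ_ _⊞ₚ_ 𝟙ₚ (_≈ₚ_ {X}) _⊥ₚ_ _⊞ₚ_ 𝟙ₚ (f *)
        *-identity : ∀ {X} (p : Pred X) → (id *) p ≈ₚ p
        *-homomorphism : ∀ {X Y Z} (f : X ⇒ Y) (g : Y ⇒ Z) (r : Pred Z) →
          ((g ∘ f) *) r ≈ₚ (f *) ((g *) r)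

Prop61 : ∀ {o ℓ} (C : Category o ℓ) (cp : Coproducts C) →
         CoproductAssumption C cp → Set (o ⊔ ℓ)
Prop61 C cp CA = Predicates.Substitution.PredFunctor C cp CA

module Submission where

-- A bound
--    b : X ⇒ (X + X) + X is read as a splitting of X into a p-part, a q-part and
--    a rest; the structural maps regroup these parts.
--  * PredicateEffectAlgebra: every effect-algebra law is a statement about
--    bounds.  Sums do not depend on the bound by joint monicity (ii);
--    commutativity, zero and orthosupplement are given by explicit bounds;
--    associativity regroups a four-part splitting obtained from the pullback
--    (E); uniqueness of the orthosupplement and the zero-one law use (K), (K+).
--  * SubstitutionIsFunctorial: f* is characterised by the universal property of
--    (D); bounds are transported along f by the pullback (D+), and
--    functoriality follows from uniqueness of mediating maps.

open import Defs
open import Data.Product using (_,_; proj₁; proj₂)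
open import Relation.Binary.PropositionalEquality
  using (_≡_; refl; sym; trans; cong; cong₂; module ≡-Reasoning)

module CoproductCalculus {o ℓ} (C : Category o ℓ) (cp : Coproducts C) where
  open Category C
  open Coproducts cp
  open Predicates C cp using (+-ext; ∘-κ₁; ∘-κ₂)

  infixl 5 _then_
  _then_ : ∀ {A B Z W} {h : B ⇒ W} {k : Z ⇒ B} {j : A ⇒ Z} {v : A ⇒ B} {w : A ⇒ W} →
           k ∘ j ≡ v → h ∘ v ≡ w → (h ∘ k) ∘ j ≡ w
  p then q = trans assoc (trans (cong (_ ∘_) p) q)

  infix 4 _⟷_
  _⟷_ : ∀ {A Z} {h k v : A ⇒ Z} → h ≡ v → k ≡ v → h ≡ k
  p ⟷ q = trans p (sym q)

  pullˡ : ∀ {A B Z W} {h : B ⇒ W} {k : Z ⇒ B} {m : Z ⇒ W} {t : A ⇒ Z} →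
          h ∘ k ≡ m → h ∘ (k ∘ t) ≡ m ∘ t
  pullˡ e = trans (sym assoc) (cong (_∘ _) e)

  precompose : ∀ {A B B′ Z W} {h : B ⇒ W} {h′ : B′ ⇒ W} {k : Z ⇒ B} {k′ : Z ⇒ B′} →
               h ∘ k ≡ h′ ∘ k′ → (t : A ⇒ Z) → h ∘ (k ∘ t) ≡ h′ ∘ (k′ ∘ t)
  precompose e t = trans (pullˡ e) assoc

  absorb : ∀ {A B Z} {κ : B ⇒ Z} {f : A ⇒ B} {j : B ⇒ A} → f ∘ j ≡ id → (κ ∘ f) ∘ j ≡ κ
  absorb e = trans assoc (trans (cong (_ ∘_) e) identityʳ)

  copair∘κ₁∘ : ∀ {A B Z W} {f : A ⇒ Z} {g : B ⇒ Z} {h : W ⇒ A} → [ f , g ] ∘ (κ₁ ∘ h) ≡ f ∘ h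
  copair∘κ₁∘ = pullˡ inject₁

  copair∘κ₂∘ : ∀ {A B Z W} {f : A ⇒ Z} {g : B ⇒ Z} {h : W ⇒ B} → [ f , g ] ∘ (κ₂ ∘ h) ≡ g ∘ h
  copair∘κ₂∘ = pullˡ inject₂

  ι₁ : ∀ {A B D} → A ⇒ (A + B) + D
  ι₁ = κ₁ ∘ κ₁

  ι₂ : ∀ {A B D} → B ⇒ (A + B) + D
  ι₂ = κ₁ ∘ κ₂

  ι₃ : ∀ {A B D} → D ⇒ (A + B) + D
  ι₃ = κ₂

  j₃ : ∀ {A D E} → D ⇒ A + (D + E)
  j₃ = κ₂ ∘ κ₁

  j₄ : ∀ {A D E} → E ⇒ A + (D + E)
  j₄ = κ₂ ∘ κ₂

  copair-ι₁ : ∀ {A B D Z} {a : A ⇒ Z} {b : B ⇒ Z} {c : D ⇒ Z} → [ [ a , b ] , c ] ∘ ι₁ ≡ a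
  copair-ι₁ = trans copair∘κ₁∘ inject₁

  copair-ι₂ : ∀ {A B D Z} {a : A ⇒ Z} {b : B ⇒ Z} {c : D ⇒ Z} → [ [ a , b ] , c ] ∘ ι₂ ≡ b
  copair-ι₂ = trans copair∘κ₁∘ inject₂

  copair-j₃ : ∀ {A D E Z} {c : A ⇒ Z} {d : D ⇒ Z} {e : E ⇒ Z} → [ c , [ d , e ] ] ∘ j₃ ≡ d
  copair-j₃ = trans copair∘κ₂∘ inject₁

  copair-j₄ : ∀ {A D E Z} {c : A ⇒ Z} {d : D ⇒ Z} {e : E ⇒ Z} → [ c , [ d , e ] ] ∘ j₄ ≡ e
  copair-j₄ = trans copair∘κ₂∘ inject₂

  private
    reassoc : ∀ {A B D Z} {h k : B ⇒ Z} {g : D ⇒ B} {j : A ⇒ D} →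
              h ∘ (g ∘ j) ≡ k ∘ (g ∘ j) → (h ∘ g) ∘ j ≡ (k ∘ g) ∘ j
    reassoc e = trans assoc (trans e (sym assoc))

  +-ext₃ : ∀ {A B D Z} {h k : (A + B) + D ⇒ Z} →
           h ∘ ι₁ ≡ k ∘ ι₁ → h ∘ ι₂ ≡ k ∘ ι₂ → h ∘ ι₃ ≡ k ∘ ι₃ → h ≡ k
  +-ext₃ e₁ e₂ e₃ = +-ext (+-ext (reassoc e₁) (reassoc e₂)) e₃

  +-ext₄ : ∀ {A B D E Z} {h k : (A + B) + (D + E) ⇒ Z} →
           h ∘ ι₁ ≡ k ∘ ι₁ → h ∘ ι₂ ≡ k ∘ ι₂ → h ∘ j₃ ≡ k ∘ j₃ → h ∘ j₄ ≡ k ∘ j₄ → h ≡ k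
  +-ext₄ e₁ e₂ e₃ e₄ = +-ext (+-ext (reassoc e₁) (reassoc e₂)) (+-ext (reassoc e₃) (reassoc e₄))

  ∘-copair : ∀ {A B Z W} {h : Z ⇒ W} {f : A ⇒ Z} {g : B ⇒ Z} → h ∘ [ f , g ] ≡ [ h ∘ f , h ∘ g ]
  ∘-copair = sym (unique ∘-κ₁ ∘-κ₂)

  +₁-∘-+₁ : ∀ {A B A′ B′ A″ B″} {f : A′ ⇒ A″} {g : B′ ⇒ B″} {h : A ⇒ A′} {k : B ⇒ B′} →
            (f +₁ g) ∘ (h +₁ k) ≡ (f ∘ h) +₁ (g ∘ k)
  +₁-∘-+₁ = trans ∘-copair (cong₂ [_,_] (trans copair∘κ₁∘ assoc) (trans copair∘κ₂∘ assoc))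

  id+₁id : ∀ {A B} → id {A} +₁ id {B} ≡ id
  id+₁id = unique (trans identityˡ (sym identityʳ)) (trans identityˡ (sym identityʳ))

  mergeˡ : ∀ {A B} → (A + A) + B ⇒ A + B
  mergeˡ = ∇ +₁ id

  mergeʳ : ∀ {A B} → A + (B + B) ⇒ A + B
  mergeʳ = id +₁ ∇

  swap₁₂ : ∀ {A B D} → (A + B) + D ⇒ (B + A) + D
  swap₁₂ = swap +₁ id

  pad : ∀ {A B D} → A + D ⇒ (A + B) + D
  pad = κ₁ +₁ id

  focus₁ : ∀ {A B D} → (A + B) + D ⇒ A + (B + D)
  focus₁ = [ [ κ₁ , κ₂ ∘ κ₁ ] , κ₂ ∘ κ₂ ]

  focus₁⁻¹ : ∀ {A B D} → A + (B + D) ⇒ (A + B) + D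
  focus₁⁻¹ = [ ι₁ , [ ι₂ , ι₃ ] ]

  focus₂ : ∀ {A B D} → (A + B) + D ⇒ B + (A + D)
  focus₂ = [ [ κ₂ ∘ κ₁ , κ₁ ] , κ₂ ∘ κ₂ ]

  mergeˡ-ι₁ : ∀ {A B} → mergeˡ {A} {B} ∘ ι₁ ≡ κ₁
  mergeˡ-ι₁ = trans copair∘κ₁∘ (absorb inject₁)

  mergeˡ-ι₂ : ∀ {A B} → mergeˡ {A} {B} ∘ ι₂ ≡ κ₁
  mergeˡ-ι₂ = trans copair∘κ₁∘ (absorb inject₂)

  mergeˡ-κ₂∘ : ∀ {A B W} {h : W ⇒ B} → mergeˡ {A} ∘ (κ₂ ∘ h) ≡ κ₂ ∘ h
  mergeˡ-κ₂∘ = trans copair∘κ₂∘ (cong (_∘ _) identityʳ)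

  mergeˡ-ι₃ : ∀ {A B} → mergeˡ {A} {B} ∘ ι₃ ≡ κ₂
  mergeˡ-ι₃ = trans inject₂ identityʳ

  mergeʳ-κ₁∘ : ∀ {A B W} {h : W ⇒ A} → mergeʳ {A} {B} ∘ (κ₁ ∘ h) ≡ κ₁ ∘ h
  mergeʳ-κ₁∘ = trans copair∘κ₁∘ (cong (_∘ _) identityʳ)

  mergeʳ-κ₁ : ∀ {A B} → mergeʳ {A} {B} ∘ κ₁ ≡ κ₁
  mergeʳ-κ₁ = trans inject₁ identityʳ

  mergeʳ-j₃ : ∀ {A B} → mergeʳ {A} {B} ∘ j₃ ≡ κ₂
  mergeʳ-j₃ = trans copair∘κ₂∘ (absorb inject₁)

  mergeʳ-j₄ : ∀ {A B} → mergeʳ {A} {B} ∘ j₄ ≡ κ₂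
  mergeʳ-j₄ = trans copair∘κ₂∘ (absorb inject₂)

  swap₁₂-ι₁ : ∀ {A B D} → swap₁₂ {A} {B} {D} ∘ ι₁ ≡ ι₂
  swap₁₂-ι₁ = trans copair∘κ₁∘ (trans assoc (cong (κ₁ ∘_) inject₁))

  swap₁₂-ι₂ : ∀ {A B D} → swap₁₂ {A} {B} {D} ∘ ι₂ ≡ ι₁
  swap₁₂-ι₂ = trans copair∘κ₁∘ (trans assoc (cong (κ₁ ∘_) inject₂))

  swap₁₂-ι₃ : ∀ {A B D} → swap₁₂ {A} {B} {D} ∘ ι₃ ≡ ι₃
  swap₁₂-ι₃ = trans inject₂ identityʳ

  pad-κ₁ : ∀ {A B D} → pad {A} {B} {D} ∘ κ₁ ≡ ι₁
  pad-κ₁ = inject₁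

  pad-κ₂ : ∀ {A B D} → pad {A} {B} {D} ∘ κ₂ ≡ ι₃
  pad-κ₂ = trans inject₂ identityʳ

  module _ {X : Obj} where
    ▷₁-ι₁ : ▷₁ {X} ∘ ι₁ ≡ κ₁
    ▷₁-ι₁ = trans copair∘κ₁∘ identityˡ

    ▷₁-ι₂ : ▷₁ {X} ∘ ι₂ ≡ κ₂
    ▷₁-ι₂ = trans copair∘κ₁∘ identityˡ

    ▷₁-ι₃ : ▷₁ {X} ∘ ι₃ ≡ κ₂
    ▷₁-ι₃ = inject₂

    ▷₂-ι₁ : ▷₂ {X} ∘ ι₁ ≡ κ₂
    ▷₂-ι₁ = trans copair∘κ₁∘ inject₁

    ▷₂-ι₂ : ▷₂ {X} ∘ ι₂ ≡ κ₁
    ▷₂-ι₂ = trans copair∘κ₁∘ inject₂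

    ▷₂-ι₃ : ▷₂ {X} ∘ ι₃ ≡ κ₂
    ▷₂-ι₃ = inject₂

    -- ▷₁ read in the coordinates of focus₂.
    ▷₁′ : X + (X + X) ⇒ X + X
    ▷₁′ = [ κ₂ , [ κ₁ , κ₂ ] ]

    ▷₁∘swap₁₂ : ▷₁ ∘ swap₁₂ ≡ ▷₂ {X}
    ▷₁∘swap₁₂ = +-ext₃ (swap₁₂-ι₁ then ▷₁-ι₂ ⟷ ▷₂-ι₁) (swap₁₂-ι₂ then ▷₁-ι₁ ⟷ ▷₂-ι₂)
                       (swap₁₂-ι₃ then ▷₁-ι₃ ⟷ ▷₂-ι₃)

    ▷₂∘swap₁₂ : ▷₂ ∘ swap₁₂ ≡ ▷₁ {X}
    ▷₂∘swap₁₂ = +-ext₃ (swap₁₂-ι₁ then ▷₂-ι₂ ⟷ ▷₁-ι₁) (swap₁₂-ι₂ then ▷₂-ι₁ ⟷ ▷₁-ι₂)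
                       (swap₁₂-ι₃ then ▷₂-ι₃ ⟷ ▷₁-ι₃)

    mergeˡ∘swap₁₂ : mergeˡ ∘ swap₁₂ ≡ mergeˡ {X} {X}
    mergeˡ∘swap₁₂ = +-ext₃ (swap₁₂-ι₁ then mergeˡ-ι₂ ⟷ mergeˡ-ι₁) (swap₁₂-ι₂ then mergeˡ-ι₁ ⟷ mergeˡ-ι₂)
                           (swap₁₂-ι₃ then mergeˡ-ι₃ ⟷ mergeˡ-ι₃)

    ▷₁∘pad : ▷₁ ∘ pad ≡ id {X + X}
    ▷₁∘pad = +-ext (pad-κ₁ then ▷₁-ι₁ ⟷ identityˡ) (pad-κ₂ then ▷₁-ι₃ ⟷ identityˡ)

    ▷₂∘pad : ▷₂ ∘ pad ≡ κ₂ ∘ ∇ {X}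
    ▷₂∘pad = +-ext (pad-κ₁ then ▷₂-ι₁ ⟷ absorb inject₁) (pad-κ₂ then ▷₂-ι₃ ⟷ absorb inject₂)

    mergeˡ∘pad : mergeˡ ∘ pad ≡ id {X + X}
    mergeˡ∘pad = +-ext (pad-κ₁ then mergeˡ-ι₁ ⟷ identityˡ) (pad-κ₂ then mergeˡ-ι₃ ⟷ identityˡ)

    ▷₁≡mergeʳ∘focus₁ : ▷₁ ≡ mergeʳ ∘ focus₁ {X} {X} {X}
    ▷₁≡mergeʳ∘focus₁ = +-ext₃ (▷₁-ι₁ ⟷ copair-ι₁ then mergeʳ-κ₁) (▷₁-ι₂ ⟷ copair-ι₂ then mergeʳ-j₃)
                              (▷₁-ι₃ ⟷ inject₂ then mergeʳ-j₄)

    ▷₂≡mergeʳ∘focus₂ : ▷₂ ≡ mergeʳ ∘ focus₂ {X} {X} {X}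
    ▷₂≡mergeʳ∘focus₂ = +-ext₃ (▷₂-ι₁ ⟷ copair-ι₁ then mergeʳ-j₃) (▷₂-ι₂ ⟷ copair-ι₂ then mergeʳ-κ₁)
                              (▷₂-ι₃ ⟷ inject₂ then mergeʳ-j₄)

    ▷₁≡▷₁′∘focus₂ : ▷₁ ≡ ▷₁′ ∘ focus₂
    ▷₁≡▷₁′∘focus₂ = +-ext₃ (▷₁-ι₁ ⟷ copair-ι₁ then copair-j₃) (▷₁-ι₂ ⟷ copair-ι₂ then inject₁)
                           (▷₁-ι₃ ⟷ inject₂ then copair-j₄)

    focus₁⁻¹∘focus₁ : focus₁⁻¹ ∘ focus₁ ≡ id {(X + X) + X}
    focus₁⁻¹∘focus₁ = +-ext₃ (copair-ι₁ then inject₁ ⟷ identityˡ) (copair-ι₂ then copair-j₃ ⟷ identityˡ)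
                             (inject₂ then copair-j₄ ⟷ identityˡ)

    ∇∘▷₂ : ∇ ∘ ▷₂ ≡ ∇ ∘ mergeˡ {X} {X}
    ∇∘▷₂ = +-ext₃ (▷₂-ι₁ then inject₂ ⟷ mergeˡ-ι₁ then inject₁) (▷₂-ι₂ then inject₁ ⟷ mergeˡ-ι₂ then inject₁)
                  (▷₂-ι₃ then inject₂ ⟷ mergeˡ-ι₃ then inject₂)

    -- Regroupings of a four-part splitting (x, y, z, r) of X:
    -- β₂₃ gives (y, z, x ∨ r), β₁₍₂₃₎ gives (x, y ∨ z, r), β₍₁₂₎₃ gives (x ∨ y, z, r).
    β₂₃ : (X + X) + (X + X) ⇒ (X + X) + X
    β₂₃ = [ [ ι₃ , ι₁ ] , [ ι₂ , ι₃ ] ]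

    β₁₍₂₃₎ : (X + X) + (X + X) ⇒ (X + X) + X
    β₁₍₂₃₎ = [ [ ι₁ , ι₂ ] , [ ι₂ , ι₃ ] ]

    β₍₁₂₎₃ : (X + X) + (X + X) ⇒ (X + X) + X
    β₍₁₂₎₃ = focus₁⁻¹ ∘ mergeˡ

    β₍₁₂₎₃-ι₁ : β₍₁₂₎₃ ∘ ι₁ ≡ ι₁
    β₍₁₂₎₃-ι₁ = mergeˡ-ι₁ then inject₁

    β₍₁₂₎₃-ι₂ : β₍₁₂₎₃ ∘ ι₂ ≡ ι₁
    β₍₁₂₎₃-ι₂ = mergeˡ-ι₂ then inject₁

    β₍₁₂₎₃-j₃ : β₍₁₂₎₃ ∘ j₃ ≡ ι₂
    β₍₁₂₎₃-j₃ = mergeˡ-κ₂∘ then copair-j₃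

    β₍₁₂₎₃-j₄ : β₍₁₂₎₃ ∘ j₄ ≡ ι₃
    β₍₁₂₎₃-j₄ = mergeˡ-κ₂∘ then copair-j₄

    ▷₁∘β₂₃ : ▷₁ ∘ β₂₃ ≡ ▷₂ ∘ mergeʳ
    ▷₁∘β₂₃ = +-ext₄ (copair-ι₁ then ▷₁-ι₃ ⟷ mergeʳ-κ₁∘ then ▷₂-ι₁)
                    (copair-ι₂ then ▷₁-ι₁ ⟷ mergeʳ-κ₁∘ then ▷₂-ι₂)
                    (copair-j₃ then ▷₁-ι₂ ⟷ mergeʳ-j₃ then ▷₂-ι₃)
                    (copair-j₄ then ▷₁-ι₃ ⟷ mergeʳ-j₄ then ▷₂-ι₃)

    ▷₂∘β₂₃ : ▷₂ ∘ β₂₃ ≡ ▷₂ ∘ β₍₁₂₎₃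
    ▷₂∘β₂₃ = +-ext₄ (copair-ι₁ then ▷₂-ι₃ ⟷ β₍₁₂₎₃-ι₁ then ▷₂-ι₁)
                    (copair-ι₂ then ▷₂-ι₁ ⟷ β₍₁₂₎₃-ι₂ then ▷₂-ι₁)
                    (copair-j₃ then ▷₂-ι₂ ⟷ β₍₁₂₎₃-j₃ then ▷₂-ι₂)
                    (copair-j₄ then ▷₂-ι₃ ⟷ β₍₁₂₎₃-j₄ then ▷₂-ι₃)

    ▷₁∘β₁₍₂₃₎ : ▷₁ ∘ β₁₍₂₃₎ ≡ ▷₁ ∘ mergeʳ
    ▷₁∘β₁₍₂₃₎ = +-ext₄ (copair-ι₁ then ▷₁-ι₁ ⟷ mergeʳ-κ₁∘ then ▷₁-ι₁)
                       (copair-ι₂ then ▷₁-ι₂ ⟷ mergeʳ-κ₁∘ then ▷₁-ι₂)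
                       (copair-j₃ then ▷₁-ι₂ ⟷ mergeʳ-j₃ then ▷₁-ι₃)
                       (copair-j₄ then ▷₁-ι₃ ⟷ mergeʳ-j₄ then ▷₁-ι₃)

    ▷₂∘β₁₍₂₃₎ : ▷₂ ∘ β₁₍₂₃₎ ≡ mergeˡ ∘ β₂₃
    ▷₂∘β₁₍₂₃₎ = +-ext₄ (copair-ι₁ then ▷₂-ι₁ ⟷ copair-ι₁ then mergeˡ-ι₃)
                       (copair-ι₂ then ▷₂-ι₂ ⟷ copair-ι₂ then mergeˡ-ι₁)
                       (copair-j₃ then ▷₂-ι₂ ⟷ copair-j₃ then mergeˡ-ι₂)
                       (copair-j₄ then ▷₂-ι₃ ⟷ copair-j₄ then mergeˡ-ι₃)

    mergeˡ∘β₁₍₂₃₎ : mergeˡ ∘ β₁₍₂₃₎ ≡ mergeˡ ∘ β₍₁₂₎₃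
    mergeˡ∘β₁₍₂₃₎ = +-ext₄ (copair-ι₁ then mergeˡ-ι₁ ⟷ β₍₁₂₎₃-ι₁ then mergeˡ-ι₁)
                           (copair-ι₂ then mergeˡ-ι₂ ⟷ β₍₁₂₎₃-ι₂ then mergeˡ-ι₁)
                           (copair-j₃ then mergeˡ-ι₂ ⟷ β₍₁₂₎₃-j₃ then mergeˡ-ι₂)
                           (copair-j₄ then mergeˡ-ι₃ ⟷ β₍₁₂₎₃-j₄ then mergeˡ-ι₃)

  module _ {X Y : Obj} (f : X ⇒ Y) where
    private
      f³-ι₁ : ((f +₁ f) +₁ f) ∘ ι₁ ≡ κ₁ ∘ (κ₁ ∘ f)
      f³-ι₁ = trans copair∘κ₁∘ (trans assoc (cong (κ₁ ∘_) inject₁))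

      f³-ι₂ : ((f +₁ f) +₁ f) ∘ ι₂ ≡ κ₁ ∘ (κ₂ ∘ f)
      f³-ι₂ = trans copair∘κ₁∘ (trans assoc (cong (κ₁ ∘_) inject₂))

      f³-ι₃ : ((f +₁ f) +₁ f) ∘ ι₃ ≡ κ₂ ∘ f
      f³-ι₃ = inject₂

    ▷₁-natural : ▷₁ ∘ ((f +₁ f) +₁ f) ≡ (f +₁ f) ∘ ▷₁
    ▷₁-natural = +-ext₃ (f³-ι₁ then trans copair∘κ₁∘ identityˡ ⟷ ▷₁-ι₁ then inject₁)
                        (f³-ι₂ then trans copair∘κ₁∘ identityˡ ⟷ ▷₁-ι₂ then inject₂)
                        (f³-ι₃ then copair∘κ₂∘ ⟷ ▷₁-ι₃ then inject₂)

    ▷₂-natural : ▷₂ ∘ ((f +₁ f) +₁ f) ≡ (f +₁ f) ∘ ▷₂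
    ▷₂-natural = +-ext₃ (f³-ι₁ then trans copair∘κ₁∘ copair∘κ₁∘ ⟷ ▷₂-ι₁ then inject₂)
                        (f³-ι₂ then trans copair∘κ₁∘ copair∘κ₂∘ ⟷ ▷₂-ι₂ then inject₁)
                        (f³-ι₃ then copair∘κ₂∘ ⟷ ▷₂-ι₃ then inject₂)

module PredicateEffectAlgebra {o ℓ} (C : Category o ℓ) (cp : Coproducts C)
                              (CA : CoproductAssumption C cp) where
  open Category C
  open Coproducts cp
  open Predicates C cp
  open CoproductAssumption CA
  open CoproductCalculus C cp
  open ≡-Reasoning

  module _ {X : Obj} where
    bound-unique : ∀ {p p′ q q′ : Pred X} (d : p ⊥ₚ q) (d′ : p′ ⊥ₚ q′) →
                   p ≈ₚ p′ → q ≈ₚ q′ → proj₁ d ≡ proj₁ d′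
    bound-unique (b , e₁ , e₂) (b′ , e₁′ , e₂′) p≈p′ q≈q′ =
      jointly-monic (trans e₁ (trans p≈p′ (sym e₁′))) (trans e₂ (trans q≈q′ (sym e₂′)))

    ⊥ₚ-resp-≈ : ∀ {p p′ q q′ : Pred X} → p ≈ₚ p′ → q ≈ₚ q′ → p ⊥ₚ q → p′ ⊥ₚ q′
    ⊥ₚ-resp-≈ p≈p′ q≈q′ (b , e₁ , e₂) = b , trans e₁ p≈p′ , trans e₂ q≈q′

    ⊞ₚ-cong : ∀ {p p′ q q′ : Pred X} (d : p ⊥ₚ q) (d′ : p′ ⊥ₚ q′) →
              p ≈ₚ p′ → q ≈ₚ q′ → (p ⊞ₚ q) d ≈ₚ (p′ ⊞ₚ q′) d′
    ⊞ₚ-cong {p} {p′} {q} {q′} d d′ p≈p′ q≈q′ =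
      cong (mergeˡ ∘_) (bound-unique {p} {p′} {q} {q′} d d′ p≈p′ q≈q′)

    ⊥ₚ-comm : ∀ {p q : Pred X} → p ⊥ₚ q → q ⊥ₚ p
    ⊥ₚ-comm (b , e₁ , e₂) = swap₁₂ ∘ b , trans (pullˡ ▷₁∘swap₁₂) e₂ , trans (pullˡ ▷₂∘swap₁₂) e₁

    ⊞ₚ-comm : ∀ {p q : Pred X} (d : p ⊥ₚ q) → (p ⊞ₚ q) d ≈ₚ (q ⊞ₚ p) (⊥ₚ-comm {p} {q} d)
    ⊞ₚ-comm (b , _ , _) = sym (pullˡ (mergeˡ∘swap₁₂ {X}))

    ⊥ₚ-𝟘 : ∀ {p : Pred X} → p ⊥ₚ 𝟘ₚ
    ⊥ₚ-𝟘 {p} = pad ∘ map p , trans (pullˡ ▷₁∘pad) identityˡ , ▷₂-part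
      where
        ▷₂-part : ▷₂ ∘ (pad ∘ map p) ≡ κ₂
        ▷₂-part = begin
          ▷₂ ∘ (pad ∘ map p)  ≡⟨ pullˡ ▷₂∘pad ⟩
          (κ₂ ∘ ∇) ∘ map p    ≡⟨ assoc ⟩
          κ₂ ∘ (∇ ∘ map p)    ≡⟨ cong (κ₂ ∘_) (law p) ⟩
          κ₂ ∘ id             ≡⟨ identityʳ ⟩
          κ₂                  ∎

    ⊞ₚ-identityʳ : ∀ {p : Pred X} → (p ⊞ₚ 𝟘ₚ) (⊥ₚ-𝟘 {p}) ≈ₚ p
    ⊞ₚ-identityʳ = trans (pullˡ mergeˡ∘pad) identityˡ

    ⊥ₚ-ᗮ : ∀ {p : Pred X} → p ⊥ₚ (p ᗮₚ)
    ⊥ₚ-ᗮ {p} = κ₁ ∘ map p , trans (pullˡ inject₁) identityˡ , pullˡ inject₁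

    ⊞ₚ-ᗮ : ∀ {p : Pred X} → (p ⊞ₚ (p ᗮₚ)) (⊥ₚ-ᗮ {p}) ≈ₚ 𝟙ₚ
    ⊞ₚ-ᗮ {p} = begin
      mergeˡ ∘ (κ₁ ∘ map p)  ≡⟨ pullˡ inject₁ ⟩
      (κ₁ ∘ ∇) ∘ map p       ≡⟨ assoc ⟩
      κ₁ ∘ (∇ ∘ map p)       ≡⟨ cong (κ₁ ∘_) (law p) ⟩
      κ₁ ∘ id                ≡⟨ identityʳ ⟩
      κ₁                     ∎

    -- A bound with sum 1 has no third part: it factors through κ₁ (pullback (K)).
    full-bound : (b : X ⇒ (X + X) + X) → mergeˡ ∘ b ≡ κ₁ → b ≡ κ₁ ∘ (▷₁ ∘ b)
    full-bound b sum≡1 = begin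
      b               ≡⟨ sym κ₁∘u≡b ⟩
      κ₁ ∘ u          ≡⟨ cong (κ₁ ∘_) u≡▷₁∘b ⟩
      κ₁ ∘ (▷₁ ∘ b)   ∎
      where
        square : κ₁ ∘ id ≡ mergeˡ ∘ b
        square = trans identityʳ (sym sum≡1)

        u : X ⇒ X + X
        u = IsPullback.universal (K {A = X} ∇) id b square

        κ₁∘u≡b : κ₁ ∘ u ≡ b
        κ₁∘u≡b = IsPullback.p₂∘universal (K {A = X} ∇) square

        u≡▷₁∘b : u ≡ ▷₁ ∘ b
        u≡▷₁∘b = begin
          u               ≡⟨ sym identityˡ ⟩
          id ∘ u          ≡⟨ sym (pullˡ inject₁) ⟩
          ▷₁ ∘ (κ₁ ∘ u)   ≡⟨ cong (▷₁ ∘_) κ₁∘u≡b ⟩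
          ▷₁ ∘ b          ∎

    ᗮₚ-unique : ∀ {p q : Pred X} (d : p ⊥ₚ q) → (p ⊞ₚ q) d ≈ₚ 𝟙ₚ → q ≈ₚ (p ᗮₚ)
    ᗮₚ-unique {p} {q} (b , e₁ , e₂) sum≡1 = begin
      map q                  ≡⟨ sym e₂ ⟩
      ▷₂ ∘ b                 ≡⟨ cong (▷₂ ∘_) (full-bound b sum≡1) ⟩
      ▷₂ ∘ (κ₁ ∘ (▷₁ ∘ b))   ≡⟨ pullˡ inject₁ ⟩
      swap ∘ (▷₁ ∘ b)        ≡⟨ cong (swap ∘_) e₁ ⟩
      swap ∘ map p           ∎

    -- A bound whose second part is 1 lies in the second summand (pullback (K+)).
    bound-with-𝟙 : (b : X ⇒ (X + X) + X) → ▷₂ ∘ b ≡ κ₁ → focus₂ ∘ b ≡ κ₁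
    bound-with-𝟙 b ▷₂b≡1 = begin
      focus₂ ∘ b  ≡⟨ sym (IsPullback.p₂∘universal (K+ id ∇) square) ⟩
      κ₁ ∘ u      ≡⟨ cong (κ₁ ∘_) u≡id ⟩
      κ₁ ∘ id     ≡⟨ identityʳ ⟩
      κ₁          ∎
      where
        square : κ₁ ∘ id ≡ mergeʳ ∘ (focus₂ ∘ b)
        square = trans identityʳ (sym (trans (pullˡ (sym ▷₂≡mergeʳ∘focus₂)) ▷₂b≡1))

        u : X ⇒ X
        u = IsPullback.universal (K+ id ∇) id (focus₂ ∘ b) square

        u≡id : u ≡ id
        u≡id = trans (sym identityˡ) (IsPullback.p₁∘universal (K+ id ∇) square)

    zero-one : ∀ {p : Pred X} → p ⊥ₚ 𝟙ₚ → p ≈ₚ 𝟘ₚ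
    zero-one {p} (b , e₁ , e₂) = begin
      map p               ≡⟨ sym e₁ ⟩
      ▷₁ ∘ b              ≡⟨ cong (_∘ b) ▷₁≡▷₁′∘focus₂ ⟩
      (▷₁′ ∘ focus₂) ∘ b  ≡⟨ assoc ⟩
      ▷₁′ ∘ (focus₂ ∘ b)  ≡⟨ cong (▷₁′ ∘_) (bound-with-𝟙 b e₂) ⟩
      ▷₁′ ∘ κ₁            ≡⟨ inject₁ ⟩
      κ₂                  ∎

    -- For a bound b of x, y and a bound c of x ⊞ y, z, the
    -- pullback (E) yields a four-part splitting t = (x, y, z, rest) with
    -- mergeʳ ∘ t = b and mergeˡ ∘ t = focus₁ ∘ c; its regroupings β₂₃ ∘ t and
    -- β₁₍₂₃₎ ∘ t bound y, z and x, y ⊞ z, while β₍₁₂₎₃ ∘ t recovers c.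
    module Associativity {x y z : Pred X} (d : x ⊥ₚ y) (e : (x ⊞ₚ y) d ⊥ₚ z) where
      private
        b : X ⇒ (X + X) + X
        b = proj₁ d

        c : X ⇒ (X + X) + X
        c = proj₁ e

        square : mergeʳ ∘ (focus₁ ∘ c) ≡ mergeˡ ∘ b
        square = trans (pullˡ (sym ▷₁≡mergeʳ∘focus₁)) (proj₁ (proj₂ e))

        t : X ⇒ (X + X) + (X + X)
        t = IsPullback.universal (E ∇ ∇) (focus₁ ∘ c) b square

        mergeˡ∘t : mergeˡ ∘ t ≡ focus₁ ∘ c
        mergeˡ∘t = IsPullback.p₁∘universal (E ∇ ∇) square

        mergeʳ∘t : mergeʳ ∘ t ≡ b
        mergeʳ∘t = IsPullback.p₂∘universal (E ∇ ∇) square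

        β₍₁₂₎₃∘t : β₍₁₂₎₃ ∘ t ≡ c
        β₍₁₂₎₃∘t = begin
          (focus₁⁻¹ ∘ mergeˡ) ∘ t   ≡⟨ assoc ⟩
          focus₁⁻¹ ∘ (mergeˡ ∘ t)   ≡⟨ cong (focus₁⁻¹ ∘_) mergeˡ∘t ⟩
          focus₁⁻¹ ∘ (focus₁ ∘ c)   ≡⟨ pullˡ focus₁⁻¹∘focus₁ ⟩
          id ∘ c                    ≡⟨ identityˡ ⟩
          c                         ∎

      bound₂₃ : y ⊥ₚ z
      bound₂₃ = β₂₃ ∘ t
              , trans (precompose ▷₁∘β₂₃ t) (trans (cong (▷₂ ∘_) mergeʳ∘t) (proj₂ (proj₂ d)))
              , trans (precompose ▷₂∘β₂₃ t) (trans (cong (▷₂ ∘_) β₍₁₂₎₃∘t) (proj₂ (proj₂ e)))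

      bound₁₍₂₃₎ : x ⊥ₚ (y ⊞ₚ z) bound₂₃
      bound₁₍₂₃₎ = β₁₍₂₃₎ ∘ t
                 , trans (precompose ▷₁∘β₁₍₂₃₎ t) (trans (cong (▷₁ ∘_) mergeʳ∘t) (proj₁ (proj₂ d)))
                 , precompose ▷₂∘β₁₍₂₃₎ t

      sum-assoc : ((x ⊞ₚ y) d ⊞ₚ z) e ≈ₚ (x ⊞ₚ (y ⊞ₚ z) bound₂₃) bound₁₍₂₃₎
      sum-assoc = begin
        mergeˡ ∘ c                ≡⟨ cong (mergeˡ ∘_) (sym β₍₁₂₎₃∘t) ⟩
        mergeˡ ∘ (β₍₁₂₎₃ ∘ t)     ≡⟨ sym (precompose mergeˡ∘β₁₍₂₃₎ t) ⟩
        mergeˡ ∘ (β₁₍₂₃₎ ∘ t)     ∎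

  Pred-isEffectAlgebra : (X : Obj) → IsEffectAlgebra (_≈ₚ_ {X}) _⊥ₚ_ _⊞ₚ_ 𝟘ₚ 𝟙ₚ _ᗮₚ
  Pred-isEffectAlgebra X = record
    { isEquivalence = record { refl = refl ; sym = sym ; trans = trans }
    ; ⊥-resp-≈ = λ {p} {p′} {q} {q′} → ⊥ₚ-resp-≈ {X} {p} {p′} {q} {q′}
    ; ⊞-cong = λ {p} {p′} {q} {q′} → ⊞ₚ-cong {X} {p} {p′} {q} {q′}
    ; ᗮ-cong = cong (swap ∘_)
    ; ⊥-comm = λ {p} {q} → ⊥ₚ-comm {X} {p} {q}
    ; ⊞-comm = λ {p} {q} → ⊞ₚ-comm {X} {p} {q}
    ; ⊥-assocʳ = λ {x} {y} {z} → Associativity.bound₂₃ {X} {x} {y} {z}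
    ; ⊥-assocˡ = λ {x} {y} {z} → Associativity.bound₁₍₂₃₎ {X} {x} {y} {z}
    ; ⊞-assoc = λ {x} {y} {z} → Associativity.sum-assoc {X} {x} {y} {z}
    ; ⊥-𝟘 = λ {p} → ⊥ₚ-𝟘 {X} {p}
    ; ⊞-identityʳ = λ {p} → ⊞ₚ-identityʳ {X} {p}
    ; ⊥-ᗮ = λ {p} → ⊥ₚ-ᗮ {X} {p}
    ; ⊞-ᗮ = λ {p} → ⊞ₚ-ᗮ {X} {p}
    ; ᗮ-unique = λ {p} {q} → ᗮₚ-unique {X} {p} {q}
    ; zero-one = λ {p} → zero-one {X} {p}
    }

module SubstitutionIsFunctorial {o ℓ} (C : Category o ℓ) (cp : Coproducts C)
                                (CA : CoproductAssumption C cp) where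
  open Category C
  open Coproducts cp
  open Predicates C cp
  open Substitution CA
  open CoproductAssumption CA
  open CoproductCalculus C cp
  open ≡-Reasoning

  module _ {X Y : Obj} (f : X ⇒ Y) where
    *-square : (q : Pred Y) → (f +₁ f) ∘ map ((f *) q) ≡ map q ∘ f
    *-square q = IsPullback.p₂∘universal (D f) _

    *-unique : (q : Pred Y) (u : X ⇒ X + X) → ∇ ∘ u ≡ id → (f +₁ f) ∘ u ≡ map q ∘ f →
               u ≡ map ((f *) q)
    *-unique q u ∇∘u≡id square = IsPullback.unique-mediator (D f) u ∇∘u≡id square

    *-cong : ∀ {p q : Pred Y} → p ≈ₚ q → (f *) p ≈ₚ (f *) q
    *-cong {p} {q} p≈q = *-unique q (map ((f *) p)) (law ((f *) p)) (trans (*-square p) (cong (_∘ f) p≈q))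

    *-pres-𝟙 : (f *) 𝟙ₚ ≈ₚ 𝟙ₚ
    *-pres-𝟙 = sym (*-unique 𝟙ₚ κ₁ inject₁ inject₁)

    -- Transport of a bound b of p, q along f: the pullback (D+) gives
    -- t : X ⇒ (X + X) + X with mergeˡ ∘ t = f*(p ⊞ q) and ((f + f) + f) ∘ t = b ∘ f;
    -- its components are f*(p) and f*(q).
    module Transport {p q : Pred Y} (d : p ⊥ₚ q) where
      private
        b : Y ⇒ (Y + Y) + Y
        b = proj₁ d

        square : (f +₁ f) ∘ map ((f *) ((p ⊞ₚ q) d)) ≡ mergeˡ ∘ (b ∘ f)
        square = trans (*-square ((p ⊞ₚ q) d)) assoc

      t : X ⇒ (X + X) + X
      t = IsPullback.universal (D+ f) (map ((f *) ((p ⊞ₚ q) d))) (b ∘ f) square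

      mergeˡ∘t : mergeˡ ∘ t ≡ map ((f *) ((p ⊞ₚ q) d))
      mergeˡ∘t = IsPullback.p₁∘universal (D+ f) square

      private
        f³∘t : ((f +₁ f) +₁ f) ∘ t ≡ b ∘ f
        f³∘t = IsPullback.p₂∘universal (D+ f) square

        transported-leg : (φ : ∀ {Z} → (Z + Z) + Z ⇒ Z + Z) →
                          ∇ ∘ φ ≡ ∇ ∘ mergeˡ → φ ∘ ((f +₁ f) +₁ f) ≡ (f +₁ f) ∘ φ →
                          (r : Pred Y) → φ ∘ b ≡ map r → φ ∘ t ≡ map ((f *) r)
        transported-leg φ ∇∘φ natural r φ∘b≡r = *-unique r (φ ∘ t) total square′
          where
            total : ∇ ∘ (φ ∘ t) ≡ id
            total = begin
              ∇ ∘ (φ ∘ t)                      ≡⟨ precompose ∇∘φ t ⟩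
              ∇ ∘ (mergeˡ ∘ t)                 ≡⟨ cong (∇ ∘_) mergeˡ∘t ⟩
              ∇ ∘ map ((f *) ((p ⊞ₚ q) d))     ≡⟨ law ((f *) ((p ⊞ₚ q) d)) ⟩
              id                               ∎

            square′ : (f +₁ f) ∘ (φ ∘ t) ≡ map r ∘ f
            square′ = begin
              (f +₁ f) ∘ (φ ∘ t)              ≡⟨ sym (precompose natural t) ⟩
              φ ∘ (((f +₁ f) +₁ f) ∘ t)       ≡⟨ cong (φ ∘_) f³∘t ⟩
              φ ∘ (b ∘ f)                     ≡⟨ pullˡ φ∘b≡r ⟩
              map r ∘ f                       ∎

      bound : (f *) p ⊥ₚ (f *) q
      bound = t
            , transported-leg ▷₁ (sym ∇∘∇+id) (▷₁-natural f) p (proj₁ (proj₂ d))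
            , transported-leg ▷₂ ∇∘▷₂ (▷₂-natural f) q (proj₂ (proj₂ d))

    *-isEAMap : IsEAMap (_≈ₚ_ {Y}) _⊥ₚ_ _⊞ₚ_ 𝟙ₚ (_≈ₚ_ {X}) _⊥ₚ_ _⊞ₚ_ 𝟙ₚ (f *)
    *-isEAMap = record
      { h-cong = λ {p} {q} → *-cong {p} {q}
      ; pres-𝟙 = *-pres-𝟙
      ; pres-⊥ = λ {p} {q} → Transport.bound {p} {q}
      ; pres-⊞ = λ {p} {q} d → sym (Transport.mergeˡ∘t {p} {q} d)
      }

  *-identity : ∀ {X} (p : Pred X) → (id *) p ≈ₚ p
  *-identity p = sym (*-unique id p (map p) (law p) square)
    where
      square : (id +₁ id) ∘ map p ≡ map p ∘ id
      square = trans (cong (_∘ map p) id+₁id) (trans identityˡ (sym identityʳ))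

  *-homomorphism : ∀ {X Y Z} (f : X ⇒ Y) (g : Y ⇒ Z) (r : Pred Z) →
                   ((g ∘ f) *) r ≈ₚ (f *) ((g *) r)
  *-homomorphism f g r = sym (*-unique (g ∘ f) r (map f*g*r) (law f*g*r) square)
    where
      f*g*r : Pred _
      f*g*r = (f *) ((g *) r)

      square : ((g ∘ f) +₁ (g ∘ f)) ∘ map f*g*r ≡ map r ∘ (g ∘ f)
      square = begin
        ((g ∘ f) +₁ (g ∘ f)) ∘ map f*g*r   ≡⟨ cong (_∘ map f*g*r) (sym +₁-∘-+₁) ⟩
        ((g +₁ g) ∘ (f +₁ f)) ∘ map f*g*r  ≡⟨ assoc ⟩
        (g +₁ g) ∘ ((f +₁ f) ∘ map f*g*r)  ≡⟨ cong ((g +₁ g) ∘_) (*-square f ((g *) r)) ⟩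
        (g +₁ g) ∘ (map ((g *) r) ∘ f)     ≡⟨ pullˡ (*-square g r) ⟩
        (map r ∘ g) ∘ f                    ≡⟨ assoc ⟩
        map r ∘ (g ∘ f)                    ∎

proposition6p1 : ∀ {o ℓ} (C : Category o ℓ) (cp : Coproducts C) (CA : CoproductAssumption C cp) → Prop61 C cp CA
proposition6p1 C cp CA = record
  { Pred-isEffectAlgebra = Pred-isEffectAlgebra
  ; *-isEAMap = *-isEAMap
  ; *-identity = *-identity
  ; *-homomorphism = *-homomorphism
  }
  where
    open PredicateEffectAlgebra C cp CA using (Pred-isEffectAlgebra)
    open SubstitutionIsFunctorial C cp CA using (*-isEAMap; *-identity; *-homomorphism)
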